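{- Let $f$ be a Matoušek AUSO on $n$ bits. Then for every $k\in[n]$ and every $y\in\{0,1\}^{[k-1]}$ there is $b\in\{0,1\}$ such that for all $z\in\{0,1\}^{[n]\setminus[k]}$, $f(ybz)>f(y\bar b z)$.
   Context: Here $ybz$ denotes the assignment in $\{0,1\}^n$ whose bits $1,\dots,k-1$ are given by $y$, bit $k$ equals $b$, and bits $k+1,\dots,n$ are given by $z$; $\bar b=1-b$. A Matoušek AUSO is a function $f:\{0,1\}^n\to\mathbb{Z}$ of the form $f(x)=-\sum_{i=1}^n2^{n-i}P_i(x[R_i])$, where for each $i$, $R_i$ is a set with $i\in R_i\subseteq[i]$, $x[R_i]$ is the restriction of $x$ to $R_i$, and $P_i:\{0,1\}^{R_i}\to\{0,1\}$ is the parity function (sum of its inputs modulo $2$). -}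

module Defs where

open import Data.Nat using (ℕ; _∸_; _^_)
open import Data.Integer using (ℤ; +_; -_)
open import Data.Bool using (Bool; true; false; _∧_; _xor_; if_then_else_)
open import Data.Fin using (Fin; toℕ; _≤_; _<_)
open import Data.Fin.Properties using (<-cmp)
open import Data.Fin.Subset using (Subset; _∈_)
open import Data.Vec using (lookup)
open import Data.List using (List; foldr; tabulate)
open import Data.Nat.ListAction using (sum)
open import Data.Product using (Σ; _×_)
open import Relation.Binary.PropositionalEquality using (_≡_)
open import Relation.Binary.Definitions using (tri<; tri≈; tri>)

-- An assignment in {0,1}^n; bit i (1-indexed in the paper) is index i-1 here.
Assignment : ℕ → Set
Assignment n = Fin n → Bool

ValidR : (n : ℕ) → (Fin n → Subset n) → Set
ValidR n R = (i : Fin n) → (i ∈ R i) × ((j : Fin n) → j ∈ R i → j ≤ i)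

parity : {n : ℕ} → Subset n → Assignment n → Bool
parity {n} S x = foldr _xor_ false (tabulate {n = n} (λ j → lookup S j ∧ x j))

bit : Bool → ℕ
bit true = 1
bit false = 0

-- f(x) = - Σ_{i=1}^n 2^{n-i} P_i(x[R_i]);  with 0-indexed i the weight is 2^{n-1-i}.
matousekFun : (n : ℕ) → (Fin n → Subset n) → Assignment n → ℤ
matousekFun n R x =
  - (+ sum (tabulate {n = n} (λ i → 2 ^ (n ∸ 1 ∸ toℕ i) Data.Nat.* bit (parity (R i) x))))

IsMatousekAUSO : (n : ℕ) → (Assignment n → ℤ) → Set
IsMatousekAUSO n f =
  Σ (Fin n → Subset n) (λ R → ValidR n R × ((x : Assignment n) → f x ≡ matousekFun n R x))

Before : {n : ℕ} → Fin n → Set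
Before {n} k = (j : Fin n) → j < k → Bool

After : {n : ℕ} → Fin n → Set
After {n} k = (j : Fin n) → k < j → Bool

-- The assignment  y b z  (bits before k from y, bit k = b, bits after k from z).
compose : {n : ℕ} (k : Fin n) → Before k → Bool → After k → Assignment n
compose k y b z j with <-cmp j k
... | tri< j<k _ _ = y j j<k
... | tri≈ _ _ _ = b
... | tri> _ _ k<j = z j k<j

{-# OPTIONS --safe #-}
module Submission where

-- Reading the bits of x ↦ (P₁(x[R₁]), …, Pₙ(x[Rₙ])) as a binary number with P₁ most
-- significant, f is minus that number, so comparing f(ybz) with f(yb̄z) is a
-- lexicographic comparison of the two parity vectors. For i < k we have k ∉ Rᵢ ⊆ [i],
-- so these parities agree; and Pₖ does not see z but does see bit k, so it takes the
-- value b xor c for a constant c depending on y only. Choosing b = c makes Pₖ(ybz) = 0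
-- and Pₖ(yb̄z) = 1 for every z.

open import Defs
open import Data.Bool using (Bool; true; false; not; _∧_; _xor_)
open import Data.Bool.Properties using (not-distribˡ-xor; not-distribʳ-xor; xor-same; xor-inverseˡ)
open import Data.Empty using (⊥-elim)
open import Data.Fin using (Fin; zero; suc; toℕ; _≤_; _<_)
open import Data.Fin.Properties using (<-cmp; <-irrefl; suc-injective)
open import Data.Fin.Subset using (Subset; _∈_)
open import Data.Integer using (ℤ; _>_)
import Data.Integer as ℤ
import Data.Integer.Properties as ℤ
open import Data.List using (foldr; tabulate)
open import Data.List.Properties using (tabulate-cong)
import Data.Nat as ℕ
open import Data.Nat using (ℕ; zero; suc; _+_; _*_; _^_; _∸_; z≤n; s≤s)
import Data.Nat.Properties as ℕ
open import Data.Nat.ListAction using (sum)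
open import Data.Product using (Σ; _,_; proj₁; proj₂)
open import Data.Vec using (lookup)
open import Data.Vec.Properties using ([]=⇒lookup; lookup⇒[]=)
open import Relation.Binary.Definitions using (tri<; tri≈; tri>)
open import Relation.Binary.PropositionalEquality
  using (_≡_; _≢_; refl; sym; trans; cong; subst; subst₂; module ≡-Reasoning)

binaryValue : (n : ℕ) → (Fin n → Bool) → ℕ
binaryValue zero    a = 0
binaryValue (suc n) a = 2 ^ n * bit (a zero) + binaryValue n (λ i → a (suc i))

sum-weightedBits≡binaryValue : ∀ n (a : Fin n → Bool) →
  sum (tabulate {n = n} (λ i → 2 ^ (n ∸ 1 ∸ toℕ i) * bit (a i))) ≡ binaryValue n a
sum-weightedBits≡binaryValue zero    a = refl
sum-weightedBits≡binaryValue (suc n) a = cong (2 ^ n * bit (a zero) +_) (begin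
  sum (tabulate (λ i → 2 ^ (n ∸ suc (toℕ i)) * bit (a (suc i))))
    ≡⟨ cong sum (tabulate-cong (λ i →
         cong (λ e → 2 ^ e * bit (a (suc i))) (sym (ℕ.∸-+-assoc n 1 (toℕ i))))) ⟩
  sum (tabulate (λ i → 2 ^ (n ∸ 1 ∸ toℕ i) * bit (a (suc i))))
    ≡⟨ sum-weightedBits≡binaryValue n (λ i → a (suc i)) ⟩
  binaryValue n (λ i → a (suc i)) ∎)
  where open ≡-Reasoning

bit≤1 : ∀ b → bit b ℕ.≤ 1
bit≤1 true  = s≤s z≤n
bit≤1 false = z≤n

binaryValue<2^n : ∀ n a → binaryValue n a ℕ.< 2 ^ n
binaryValue<2^n zero    a = s≤s z≤n
binaryValue<2^n (suc n) a = begin-strict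
  2 ^ n * bit (a zero) + binaryValue n (λ i → a (suc i))
    <⟨ ℕ.+-mono-≤-< (ℕ.*-monoʳ-≤ (2 ^ n) (bit≤1 (a zero))) (binaryValue<2^n n _) ⟩
  2 ^ n * 1 + 2 ^ n
    ≡⟨ cong (_+ 2 ^ n) (ℕ.*-identityʳ (2 ^ n)) ⟩
  2 ^ n + 2 ^ n
    ≡⟨ cong (2 ^ n +_) (sym (ℕ.+-identityʳ (2 ^ n))) ⟩
  2 ^ suc n ∎
  where open ℕ.≤-Reasoning

binaryValue-lex-< : ∀ n (k : Fin n) (a a′ : Fin n → Bool) → (∀ i → i < k → a i ≡ a′ i) →
  a k ≡ false → a′ k ≡ true → binaryValue n a ℕ.< binaryValue n a′
binaryValue-lex-< (suc n) zero a a′ _ ak≡false a′k≡true rewrite ak≡false | a′k≡true = begin-strict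
  2 ^ n * 0 + binaryValue n (λ i → a (suc i))
    ≡⟨ cong (_+ binaryValue n (λ i → a (suc i))) (ℕ.*-zeroʳ (2 ^ n)) ⟩
  binaryValue n (λ i → a (suc i))
    <⟨ binaryValue<2^n n _ ⟩
  2 ^ n
    ≡⟨ sym (ℕ.*-identityʳ (2 ^ n)) ⟩
  2 ^ n * 1
    ≤⟨ ℕ.m≤m+n (2 ^ n * 1) _ ⟩
  2 ^ n * 1 + binaryValue n (λ i → a′ (suc i)) ∎
  where open ℕ.≤-Reasoning
binaryValue-lex-< (suc n) (suc k) a a′ a≡a′ ak≡false a′k≡true rewrite a≡a′ zero (s≤s z≤n) =
  ℕ.+-monoʳ-< (2 ^ n * bit (a′ zero))
    (binaryValue-lex-< n k (λ i → a (suc i)) (λ i → a′ (suc i))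
      (λ i i<k → a≡a′ (suc i) (s≤s i<k)) ak≡false a′k≡true)

matousekFun≡-binaryValue : ∀ n R (x : Assignment n) →
  matousekFun n R x ≡ ℤ.- ℤ.+ binaryValue n (λ i → parity (R i) x)
matousekFun≡-binaryValue n R x =
  cong (λ m → ℤ.- ℤ.+ m) (sum-weightedBits≡binaryValue n (λ i → parity (R i) x))

matousekFun-lex-> : ∀ n R (k : Fin n) (x x′ : Assignment n) →
  (∀ i → i < k → parity (R i) x ≡ parity (R i) x′) →
  parity (R k) x ≡ false → parity (R k) x′ ≡ true → matousekFun n R x > matousekFun n R x′
matousekFun-lex-> n R k x x′ agree Pk≡false Pk′≡true =
  subst₂ ℤ._<_ (sym (matousekFun≡-binaryValue n R x′)) (sym (matousekFun≡-binaryValue n R x))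
    (ℤ.neg-mono-< (ℤ.+<+ (binaryValue-lex-< n k _ _ agree Pk≡false Pk′≡true)))

foldr-xor-flip : ∀ n (k : Fin n) (g h : Fin n → Bool) → (∀ j → j ≢ k → g j ≡ h j) →
  h k ≡ not (g k) → foldr _xor_ false (tabulate h) ≡ not (foldr _xor_ false (tabulate g))
foldr-xor-flip (suc n) zero g h g≡h hk≡not-gk
  rewrite hk≡not-gk | tabulate-cong {f = λ i → h (suc i)} (λ i → sym (g≡h (suc i) (λ ()))) =
  sym (not-distribˡ-xor (g zero) _)
foldr-xor-flip (suc n) (suc k) g h g≡h hk≡not-gk rewrite sym (g≡h zero (λ ())) =
  trans (cong (g zero xor_) (foldr-xor-flip n k (λ i → g (suc i)) (λ i → h (suc i))
          (λ j j≢k → g≡h (suc j) (λ sj≡sk → j≢k (suc-injective sj≡sk))) hk≡not-gk))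
        (sym (not-distribʳ-xor (g zero) _))

parity-cong : ∀ {n} (S : Subset n) {x x′ : Assignment n} → (∀ j → j ∈ S → x j ≡ x′ j) →
  parity S x ≡ parity S x′
parity-cong {n} S {x} {x′} x≡x′ = cong (foldr _xor_ false) (tabulate-cong masked-cong)
  where
  masked-cong : ∀ j → (lookup S j ∧ x j) ≡ (lookup S j ∧ x′ j)
  masked-cong j with lookup S j in Sj
  ... | false = refl
  ... | true  = x≡x′ j (lookup⇒[]= j S Sj)

parity-flip : ∀ {n} (S : Subset n) (k : Fin n) {x x′ : Assignment n} → k ∈ S →
  (∀ j → j ≢ k → x j ≡ x′ j) → x′ k ≡ not (x k) → parity S x′ ≡ not (parity S x)
parity-flip {n} S k {x} {x′} k∈S x≡x′ x′k≡not-xk =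
  foldr-xor-flip n k _ _ (λ j j≢k → cong (lookup S j ∧_) (x≡x′ j j≢k)) masked-flip
  where
  masked-flip : (lookup S k ∧ x′ k) ≡ not (lookup S k ∧ x k)
  masked-flip rewrite []=⇒lookup k∈S = x′k≡not-xk

module _ {n : ℕ} (k : Fin n) (y : Before k) where

  compose-≢ : ∀ b b′ z j → j ≢ k → compose k y b z j ≡ compose k y b′ z j
  compose-≢ b b′ z j j≢k with <-cmp j k
  ... | tri< _ _ _   = refl
  ... | tri≈ _ j≡k _ = ⊥-elim (j≢k j≡k)
  ... | tri> _ _ _   = refl

  compose-self : ∀ b z → compose k y b z k ≡ b
  compose-self b z with <-cmp k k
  ... | tri< k<k _ _ = ⊥-elim (<-irrefl refl k<k)
  ... | tri≈ _ _ _   = refl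
  ... | tri> _ _ k<k = ⊥-elim (<-irrefl refl k<k)

  compose-≤ : ∀ b z z′ j → j ≤ k → compose k y b z j ≡ compose k y b z′ j
  compose-≤ b z z′ j j≤k with <-cmp j k
  ... | tri< _ _ _   = refl
  ... | tri≈ _ _ _   = refl
  ... | tri> _ _ k<j = ⊥-elim (ℕ.<⇒≱ k<j j≤k)

  module _ (R : Fin n → Subset n) (valid : ValidR n R) where

    parity-compose-below : ∀ i → i < k → ∀ b b′ z →
      parity (R i) (compose k y b z) ≡ parity (R i) (compose k y b′ z)
    parity-compose-below i i<k b b′ z = parity-cong (R i) λ j j∈Ri →
      compose-≢ b b′ z j λ j≡k → ℕ.<⇒≱ i<k (subst (_≤ i) j≡k (proj₂ (valid i) j j∈Ri))

    pivot : Bool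
    pivot = parity (R k) (compose k y false (λ _ _ → false))

    parity-compose-at : ∀ b z → parity (R k) (compose k y b z) ≡ b xor pivot
    parity-compose-at false z = parity-cong (R k) λ j j∈Rk →
      compose-≤ false z _ j (proj₂ (valid k) j j∈Rk)
    parity-compose-at true z = begin
      parity (R k) (compose k y true z)
        ≡⟨ parity-flip (R k) k (proj₁ (valid k)) (λ j → compose-≢ false true z j)
             (trans (compose-self true z) (cong not (sym (compose-self false z)))) ⟩
      not (parity (R k) (compose k y false z))
        ≡⟨ cong not (parity-compose-at false z) ⟩
      not pivot ∎
      where open ≡-Reasoning

proposition6p5 : (n : ℕ) (f : Assignment n → ℤ) → IsMatousekAUSO n f →
    (k : Fin n) (y : Before k) → Σ Bool (λ b → (z : After k) →
      f (compose k y b z) > f (compose k y (not b) z))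
proposition6p5 n f (R , valid , f≡matousekFun) k y = b , λ z →
  subst₂ _>_ (sym (f≡matousekFun _)) (sym (f≡matousekFun _))
    (matousekFun-lex-> n R k _ _
      (λ i i<k → parity-compose-below k y R valid i i<k b (not b) z)
      (trans (parity-compose-at k y R valid b z) (xor-same b))
      (trans (parity-compose-at k y R valid (not b) z) (xor-inverseˡ b)))
  where
  b : Bool
  b = pivot k y R valid
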